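{- Let $N$ be an odd perfect number (i.e. $\sigma(N)=2N$). Assume that $3\mid N$, $5\mid N$ and $11\mid N$. Then $5 \,\|\, N$.
   Context: $\sigma(N)$ is the sum of the positive divisors of $N$. For a prime $p$, $p\,\|\,N$ means $p\mid N$ but $p^2\nmid N$. -}

module Defs where

open import Data.Nat using (ℕ; zero; suc; _+_; _*_)
open import Data.Nat.Divisibility using (_∣_; _∣?_)
open import Relation.Nullary.Decidable using (does)
open import Data.Bool using (if_then_else_)

σ-upto : ℕ → ℕ → ℕ
σ-upto n zero    = 0
σ-upto n (suc k) = (if does (suc k ∣? n) then suc k else 0) + σ-upto n k

σ : ℕ → ℕ
σ n = σ-upto n n

-- Euler's argument: if p ∥ N then σ(N) = (1 + p) σ(N / p), so 1 + p divides
-- σ(N) = 2N; for an odd N this forces 1 + p ≢ 0 (mod 4), hence 9 ∣ N and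
-- 121 ∣ N. If moreover 25 ∣ N, then either 27 ∣ N, or 3² ∥ N and σ(3²) = 13
-- divides 2N. Either way N has an abundant divisor, 3³·5²·11² or
-- 3²·5²·11²·13, which is impossible because σ(d)/d ≤ σ(N)/N for d ∣ N.
module Submission where

open import Defs
open import Data.Nat using (ℕ; _*_; _<_)
open import Data.Nat.Divisibility using (_∣_)
open import Relation.Binary.PropositionalEquality using (_≡_)
open import Relation.Nullary using (¬_)
open import Data.Product using (_×_)

open import Data.Bool using (if_then_else_)
open import Data.Nat using (zero; suc; _+_; _^_; _≤_; z≤n; s≤s; z<s; NonZero; _<?_)
open import Data.Nat.Coprimality using (Coprime; coprime?; coprime-divisor)
open import Data.Nat.Divisibility
  using (_∤_; divides; _∣?_; ∣-trans; ∣-reflexive; *-monoˡ-∣; *-cancelʳ-∣; *-cancelˡ-∣;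
         ∣m+n∣m⇒∣n; m∣m*n; n∣m*n; >⇒∤)
open import Data.Nat.LCM using (lcm-least)
open import Data.Nat.Primality using (Prime; prime?; prime⇒irreducible; prime⇒nonZero)
open import Data.Nat.Properties
open import Algebra.Properties.CommutativeSemigroup +-commutativeSemigroup
  using (interchange)
open import Data.Product using (_,_)
open import Data.Sum using (inj₁; inj₂)
open import Relation.Binary.PropositionalEquality
  using (refl; sym; trans; cong; cong₂; subst; module ≡-Reasoning)
open import Relation.Nullary using (yes; no; does; contradiction)
open import Relation.Nullary.Decidable using (dec-true; dec-false; from-yes)

∑ : ℕ → (ℕ → ℕ) → ℕ
∑ zero    f = 0
∑ (suc k) f = f (suc k) + ∑ k f

syntax ∑ k (λ d → e) = ∑[ d ≤ k ] e

∑-cong : ∀ k {f g} → (∀ {d} → 0 < d → d ≤ k → f d ≡ g d) → ∑ k f ≡ ∑ k g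
∑-cong zero    f≗g = refl
∑-cong (suc k) f≗g =
  cong₂ _+_ (f≗g z<s ≤-refl) (∑-cong k (λ 0<d d≤k → f≗g 0<d (m≤n⇒m≤1+n d≤k)))

∑-vanishing : ∀ k {f} → (∀ {d} → 0 < d → d ≤ k → f d ≡ 0) → ∑ k f ≡ 0
∑-vanishing zero    f≗0 = refl
∑-vanishing (suc k) f≗0 =
  cong₂ _+_ (f≗0 z<s ≤-refl) (∑-vanishing k (λ 0<d d≤k → f≗0 0<d (m≤n⇒m≤1+n d≤k)))

∑-beyond : ∀ {f m} n → m ≤ n → (∀ {d} → m < d → d ≤ n → f d ≡ 0) → ∑ n f ≡ ∑ m f
∑-beyond zero z≤n f≗0 = refl
∑-beyond (suc n) m≤1+n f≗0 with m≤n⇒m<n∨m≡n m≤1+n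
... | inj₂ refl        = refl
... | inj₁ (s≤s m≤n) =
  cong₂ _+_ (f≗0 (s≤s m≤n) ≤-refl) (∑-beyond n m≤n (λ m<d d≤n → f≗0 m<d (m≤n⇒m≤1+n d≤n)))

∑-+ : ∀ k f g → ∑[ d ≤ k ] (f d + g d) ≡ ∑ k f + ∑ k g
∑-+ zero    f g = refl
∑-+ (suc k) f g = trans (cong (f (suc k) + g (suc k) +_) (∑-+ k f g))
                        (interchange (f (suc k)) (g (suc k)) (∑ k f) (∑ k g))

∑-*ʳ : ∀ k f c → ∑[ d ≤ k ] (f d * c) ≡ ∑ k f * c
∑-*ʳ zero    f c = refl
∑-*ʳ (suc k) f c = trans (cong (f (suc k) * c +_) (∑-*ʳ k f c))
                         (sym (*-distribʳ-+ c (f (suc k)) (∑ k f)))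

∑-split : ∀ n m f → ∑ (n + m) f ≡ ∑[ d ≤ n ] f (d + m) + ∑ m f
∑-split zero    m f = refl
∑-split (suc n) m f = trans (cong (f (suc n + m) +_) (∑-split n m f))
                            (sym (+-assoc (f (suc n + m)) _ _))

if-∣-yes : ∀ {m n a b : ℕ} → m ∣ n → (if does (m ∣? n) then a else b) ≡ a
if-∣-yes {m} {n} m∣n rewrite dec-true (m ∣? n) m∣n = refl

if-∣-no : ∀ {m n a b : ℕ} → m ∤ n → (if does (m ∣? n) then a else b) ≡ b
if-∣-no {m} {n} m∤n rewrite dec-false (m ∣? n) m∤n = refl

∤-+-multiple : ∀ {p d} k → 0 < d → d < p → p ∤ d + k * p
∤-+-multiple {p} {suc _} k _ d<p p∣d+kp =
  >⇒∤ d<p (∣m+n∣m⇒∣n (subst (p ∣_) (+-comm _ (k * p)) p∣d+kp) (n∣m*n k))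

∑-multiples : ∀ p .{{_ : NonZero p}} k (h : ℕ → ℕ) →
              ∑[ d ≤ k * p ] (if does (p ∣? d) then h d else 0) ≡ ∑[ e ≤ k ] h (e * p)
∑-multiples p@(suc q) zero    h = refl
∑-multiples p@(suc q) (suc k) h = begin
  ∑ (p + k * p) f                            ≡⟨ ∑-split p (k * p) f ⟩
  ∑[ d ≤ p ] f (d + k * p) + ∑ (k * p) f     ≡⟨ cong₂ _+_ last-block (∑-multiples p k h) ⟩
  h (suc k * p) + ∑[ e ≤ k ] h (e * p)       ∎
  where
  open ≡-Reasoning
  f : ℕ → ℕ
  f d = if does (p ∣? d) then h d else 0
  last-block : ∑[ d ≤ p ] f (d + k * p) ≡ h (suc k * p)
  last-block = trans
    (cong₂ _+_ (if-∣-yes {p} (n∣m*n (suc k)))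
               (∑-vanishing q (λ {d} 0<d d≤q → if-∣-no {p} (∤-+-multiple k 0<d (s≤s d≤q)))))
    (+-identityʳ _)

δ : ℕ → ℕ → ℕ
δ n d = if does (d ∣? n) then d else 0

σ≡∑δ : ∀ n → σ n ≡ ∑ n (δ n)
σ≡∑δ n = go n
  where
  go : ∀ k → σ-upto n k ≡ ∑ k (δ n)
  go zero    = refl
  go (suc k) = cong (δ n (suc k) +_) (go k)

δ-cong : ∀ {m n d} → (d ∣ m → d ∣ n) → (d ∣ n → d ∣ m) → δ m d ≡ δ n d
δ-cong {m} {n} {d} to from with d ∣? m | d ∣? n
... | yes _   | yes _   = refl
... | no  _   | no  _   = refl
... | yes d∣m | no  d∤n = contradiction (to d∣m) d∤n
... | no  d∤m | yes d∣n = contradiction (from d∣n) d∤m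

δ-*-* : ∀ p .{{_ : NonZero p}} K e → δ (K * p) (e * p) ≡ δ K e * p
δ-*-* p K e with e ∣? K
... | yes e∣K = if-∣-yes (*-monoˡ-∣ p e∣K)
... | no  e∤K = if-∣-no (λ ep∣Kp → e∤K (*-cancelʳ-∣ p ep∣Kp))

δ-beyond : ∀ {K d} → 0 < K → K < d → δ K d ≡ 0
δ-beyond {suc _} _ K<d = if-∣-no (>⇒∤ K<d)

σ∤ σ∣ : ℕ → ℕ → ℕ
σ∤ p n = ∑[ d ≤ n ] (if does (p ∣? d) then 0 else δ n d)
σ∣ p n = ∑[ d ≤ n ] (if does (p ∣? d) then δ n d else 0)

σ-split : ∀ p n → σ n ≡ σ∤ p n + σ∣ p n
σ-split p n = begin
  σ n         ≡⟨ σ≡∑δ n ⟩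
  ∑ n (δ n)   ≡⟨ ∑-cong n (λ {d} _ _ → δ-split d) ⟩
  ∑[ d ≤ n ] ((if does (p ∣? d) then 0 else δ n d) + (if does (p ∣? d) then δ n d else 0))
              ≡⟨ ∑-+ n _ _ ⟩
  σ∤ p n + σ∣ p n ∎
  where
  open ≡-Reasoning
  δ-split : ∀ d → δ n d ≡ (if does (p ∣? d) then 0 else δ n d) + (if does (p ∣? d) then δ n d else 0)
  δ-split d with p ∣? d
  ... | yes _ = refl
  ... | no  _ = sym (+-identityʳ (δ n d))

σ∣-* : ∀ p .{{_ : NonZero p}} K → σ∣ p (K * p) ≡ σ K * p
σ∣-* p K = begin
  σ∣ p (K * p)                    ≡⟨ ∑-multiples p K (δ (K * p)) ⟩
  ∑[ e ≤ K ] δ (K * p) (e * p)    ≡⟨ ∑-cong K (λ {e} _ _ → δ-*-* p K e) ⟩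
  ∑[ e ≤ K ] (δ K e * p)          ≡⟨ ∑-*ʳ K (δ K) p ⟩
  ∑ K (δ K) * p                   ≡⟨ cong (_* p) (σ≡∑δ K) ⟨
  σ K * p                         ∎
  where open ≡-Reasoning

σ∤-∤ : ∀ {p K} → p ∤ K → σ∤ p K ≡ σ K
σ∤-∤ {p} {K} p∤K = trans (∑-cong K (λ {d} _ _ → term d)) (sym (σ≡∑δ K))
  where
  term : ∀ d → (if does (p ∣? d) then 0 else δ K d) ≡ δ K d
  term d with p ∣? d
  ... | no  _   = refl
  ... | yes p∣d = sym (if-∣-no (λ d∣K → p∤K (∣-trans p∣d d∣K)))

∤-prime⇒coprime : ∀ {p d} → Prime p → p ∤ d → Coprime d p
∤-prime⇒coprime pp p∤d (i∣d , i∣p) with prime⇒irreducible pp i∣p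
... | inj₁ i≡1  = i≡1
... | inj₂ refl = contradiction i∣d p∤d

σ∤-* : ∀ {p} → Prime p → ∀ K → σ∤ p (K * p) ≡ σ∤ p K
σ∤-* pp zero          = refl
σ∤-* {p} pp K@(suc _) = begin
  σ∤ p (K * p)                ≡⟨ ∑-cong (K * p) (λ {d} _ _ → term d) ⟩
  ∑[ d ≤ K * p ] coprimeTerm d ≡⟨ ∑-beyond (K * p) (m≤m*n K p) (λ {d} K<d _ → beyond d K<d) ⟩
  σ∤ p K                      ∎
  where
  open ≡-Reasoning
  instance _ = prime⇒nonZero pp
  coprimeTerm : ℕ → ℕ
  coprimeTerm d = if does (p ∣? d) then 0 else δ K d
  term : ∀ d → (if does (p ∣? d) then 0 else δ (K * p) d) ≡ coprimeTerm d
  term d with p ∣? d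
  ... | yes _   = refl
  ... | no  p∤d = δ-cong (λ d∣Kp → coprime-divisor (∤-prime⇒coprime pp p∤d)
                                                   (subst (d ∣_) (*-comm K p) d∣Kp))
                         (λ d∣K → ∣-trans d∣K (m∣m*n p))
  beyond : ∀ d → K < d → coprimeTerm d ≡ 0
  beyond d K<d with p ∣? d
  ... | yes _ = refl
  ... | no  _ = δ-beyond z<s K<d

m*n^[1+e]≡m*n^e*n : ∀ m n e → m * n ^ suc e ≡ m * n ^ e * n
m*n^[1+e]≡m*n^e*n m n e = trans (cong (m *_) (*-comm n (n ^ e))) (sym (*-assoc m (n ^ e) n))

σ∤-*-^ : ∀ {p} → Prime p → ∀ K e → σ∤ p (K * p ^ e) ≡ σ∤ p K
σ∤-*-^ {p} pp K zero    = cong (σ∤ p) (*-identityʳ K)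
σ∤-*-^ {p} pp K (suc e) = begin
  σ∤ p (K * p ^ suc e)      ≡⟨ cong (σ∤ p) (m*n^[1+e]≡m*n^e*n K p e) ⟩
  σ∤ p (K * p ^ e * p)      ≡⟨ σ∤-* pp (K * p ^ e) ⟩
  σ∤ p (K * p ^ e)          ≡⟨ σ∤-*-^ pp K e ⟩
  σ∤ p K                    ∎
  where open ≡-Reasoning

geomSum : ℕ → ℕ → ℕ
geomSum p zero    = 1
geomSum p (suc e) = 1 + geomSum p e * p

σ-*-^ : ∀ {p K} → Prime p → p ∤ K → ∀ e → σ (K * p ^ e) ≡ σ K * geomSum p e
σ-*-^ {p} {K} pp p∤K zero    = trans (cong σ (*-identityʳ K)) (sym (*-identityʳ (σ K)))
σ-*-^ {p} {K} pp p∤K (suc e) = begin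
  σ (K * p ^ suc e)                          ≡⟨ cong σ (m*n^[1+e]≡m*n^e*n K p e) ⟩
  σ (M * p)                                  ≡⟨ σ-split p (M * p) ⟩
  σ∤ p (M * p) + σ∣ p (M * p)                ≡⟨ cong₂ _+_ coprime-part (σ∣-* p M) ⟩
  σ K + σ M * p                              ≡⟨ cong (λ s → σ K + s * p) (σ-*-^ pp p∤K e) ⟩
  σ K + σ K * geomSum p e * p                ≡⟨ cong₂ _+_ (sym (*-identityʳ (σ K))) (*-assoc (σ K) _ p) ⟩
  σ K * 1 + σ K * (geomSum p e * p)          ≡⟨ *-distribˡ-+ (σ K) 1 _ ⟨
  σ K * geomSum p (suc e)                    ∎
  where
  open ≡-Reasoning
  instance _ = prime⇒nonZero pp
  M = K * p ^ e
  coprime-part : σ∤ p (M * p) ≡ σ K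
  coprime-part = trans (σ∤-* pp M) (trans (σ∤-*-^ pp K e) (σ∤-∤ p∤K))

σ[m]*n≤σ[m*n] : ∀ m n → σ m * n ≤ σ (m * n)
σ[m]*n≤σ[m*n] m zero        = subst (_≤ σ (m * 0)) (sym (*-zeroʳ (σ m))) z≤n
σ[m]*n≤σ[m*n] m n@(suc _) = begin
  σ m * n                         ≡⟨ σ∣-* n m ⟨
  σ∣ n (m * n)                    ≤⟨ m≤n+m _ (σ∤ n (m * n)) ⟩
  σ∤ n (m * n) + σ∣ n (m * n)     ≡⟨ σ-split n (m * n) ⟨
  σ (m * n)                       ∎
  where open ≤-Reasoning

Abundant : ℕ → Set
Abundant n = 2 * n < σ n

abundant[3³5²11²] : Abundant (3 ^ 3 * 5 ^ 2 * 11 ^ 2)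
abundant[3³5²11²] = from-yes (2 * (3 ^ 3 * 5 ^ 2 * 11 ^ 2) <? σ (3 ^ 3 * 5 ^ 2 * 11 ^ 2))

abundant[3²5²11²13] : Abundant (3 ^ 2 * 5 ^ 2 * 11 ^ 2 * 13)
abundant[3²5²11²13] = from-yes (2 * (3 ^ 2 * 5 ^ 2 * 11 ^ 2 * 13) <? σ (3 ^ 2 * 5 ^ 2 * 11 ^ 2 * 13))

perfect⇒¬abundant∣ : ∀ {N L} → 0 < N → σ N ≡ 2 * N → Abundant L → ¬ L ∣ N
perfect⇒¬abundant∣ {L = L} 0<N perfect abundant (divides Q@(suc _) refl) =
  <⇒≱ abundant (*-cancelʳ-≤ (σ L) (2 * L) Q (begin
    σ L * Q          ≤⟨ σ[m]*n≤σ[m*n] L Q ⟩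
    σ (L * Q)        ≡⟨ cong σ (*-comm L Q) ⟩
    σ (Q * L)        ≡⟨ perfect ⟩
    2 * (Q * L)      ≡⟨ cong (2 *_) (*-comm Q L) ⟩
    2 * (L * Q)      ≡⟨ *-assoc 2 L Q ⟨
    2 * L * Q        ∎))
  where open ≤-Reasoning

perfect⇒geomSum∣ : ∀ {N p r} e → Prime p → p ∤ r → σ N ≡ 2 * N → N ≡ r * p ^ e →
                   geomSum p e ∣ 2 * N
perfect⇒geomSum∣ {N} {p} {r} e pp p∤r perfect N≡rpᵉ = divides (σ r) (begin
  2 * N               ≡⟨ perfect ⟨
  σ N                 ≡⟨ cong σ N≡rpᵉ ⟩
  σ (r * p ^ e)       ≡⟨ σ-*-^ pp p∤r e ⟩
  σ r * geomSum p e   ∎)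
  where open ≡-Reasoning

odd-perfect⇒prime²∣ : ∀ {N p} → Prime p → 4 ∣ suc p → ¬ 2 ∣ N → σ N ≡ 2 * N →
                      p ∣ N → p * p ∣ N
odd-perfect⇒prime²∣ {N} {p} pp 4∣1+p N-odd perfect (divides q N≡qp) with p ∣? q
... | yes (divides r refl) = divides r (trans N≡qp (*-assoc r p p))
... | no  p∤q              = contradiction (*-cancelˡ-∣ 2 4∣2N) N-odd
  where
  1+p∣2N : suc p ∣ 2 * N
  1+p∣2N = subst (_∣ 2 * N) (cong suc (*-identityˡ p))
    (perfect⇒geomSum∣ 1 pp p∤q perfect (trans N≡qp (cong (q *_) (sym (*-identityʳ p)))))
  4∣2N : 2 * 2 ∣ 2 * N
  4∣2N = ∣-trans 4∣1+p 1+p∣2N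

lemma5 : (N : ℕ) → 0 < N → ¬ (2 ∣ N) → σ N ≡ 2 * N →
    3 ∣ N → 5 ∣ N → 11 ∣ N →
    (5 ∣ N × ¬ (5 * 5 ∣ N))
lemma5 N 0<N N-odd perfect 3∣N 5∣N 11∣N = 5∣N , 25∤N
  where
  prime[3] : Prime 3
  prime[3] = from-yes (prime? 3)
  9∣N : 3 * 3 ∣ N
  9∣N = odd-perfect⇒prime²∣ prime[3] (divides 1 refl) N-odd perfect 3∣N
  121∣N : 11 * 11 ∣ N
  121∣N = odd-perfect⇒prime²∣ (from-yes (prime? 11)) (divides 3 refl) N-odd perfect 11∣N
  ¬abundant∣N : ∀ {L} → Abundant L → ¬ L ∣ N
  ¬abundant∣N = perfect⇒¬abundant∣ 0<N perfect
  25∤N : ¬ 5 * 5 ∣ N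
  -- The lcm of pairwise coprime literals normalises to their product.
  25∤N 25∣N with 27 ∣? N | 9∣N
  ... | yes 27∣N | _ =
    ¬abundant∣N abundant[3³5²11²]
      (lcm-least 27∣N (lcm-least 25∣N 121∣N))
  ... | no 27∤N | divides r N≡9r =
    ¬abundant∣N abundant[3²5²11²13]
      (lcm-least 9∣N (lcm-least 25∣N (lcm-least 121∣N 13∣N)))
    where
    3∤r : 3 ∤ r
    3∤r 3∣r = 27∤N (∣-trans (*-monoˡ-∣ 9 3∣r) (∣-reflexive (sym N≡9r)))
    -- geomSum 3 2 = σ(3²) = 13
    13∣N : 13 ∣ N
    13∣N = coprime-divisor (from-yes (coprime? 13 2))
                           (perfect⇒geomSum∣ 2 prime[3] 3∤r perfect N≡9r)
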